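{- Every semi-Nelson algebra $\langle T,\wedge,\vee,\rightarrow,\sim,1\rangle$, regarded as an algebra $\langle T,\wedge,\vee,\rightarrow,\sim,0,1\rangle$ with $0:=\sim 1$, is a hemi-Nelson algebra.
   Context: Write $x\rightarrow_N y$ for $x\rightarrow(x\wedge y)$. A semi-Nelson algebra is an algebra $\langle T,\wedge,\vee,\rightarrow,\sim,1\rangle$ of type $(2,2,2,1,0)$ such that for all $x,y,z\in T$: (SN1) $x\wedge(x\vee y)=x$; (SN2) $x\wedge(y\vee z)=(z\wedge x)\vee(y\wedge x)$; (SN3) $\sim\sim x=x$; (SN4) $\sim(x\wedge y)=\sim x\vee\sim y$; (SN5) $x\wedge\sim x=(x\wedge\sim x)\wedge(y\vee\sim y)$; (SN6) $x\wedge(x\rightarrow_N y)=x\wedge(\sim x\vee y)$; (SN7) $x\rightarrow_N(y\rightarrow_N z)=(x\wedge y)\rightarrow_N z$; (SN8) $(x\rightarrow_N y)\rightarrow_N[(y\rightarrow_N x)\rightarrow_N[(x\rightarrow z)\rightarrow_N(y\rightarrow z)]]=1$; (SN9) $(x\rightarrow_N y)\rightarrow_N[(y\rightarrow_N x)\rightarrow_N[(z\rightarrow x)\rightarrow_N(z\rightarrow y)]]=1$; (SN10) $\sim(x\rightarrow y)\rightarrow_N(x\wedge\sim y)=1$; (SN11) $(x\wedge\sim y)\rightarrow_N\sim(x\rightarrow y)=1$. A Kleene algebra is a bounded distributive lattice $\langle T,\wedge,\vee,0,1\rangle$ with a unary operation $\sim$ such that $\sim\sim x=x$, $\sim(x\wedge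 y)=\sim x\vee\sim y$ and $(x\wedge\sim x)\wedge(y\vee\sim y)=x\wedge\sim x$. A hemi-Nelson algebra is an algebra $\langle T,\wedge,\vee,\rightarrow,\sim,0,1\rangle$ of type $(2,2,2,1,0,0)$ such that $\langle T,\wedge,\vee,\sim,0,1\rangle$ is a Kleene algebra and for all $x,y,z\in T$: (hN1) $x\rightarrow x=1$; (hN2) $x\wedge(x\rightarrow y)\le x\wedge(\sim x\vee y)$; (hN3) $\sim(x\rightarrow y)\rightarrow(x\wedge\sim y)=1$; (hN4) $(x\wedge\sim y)\rightarrow\sim(x\rightarrow y)=1$; (hN5) $(x\wedge y\wedge(x\rightarrow y))\rightarrow(x\wedge(x\rightarrow y))=1$; (hN6) $(x\wedge(x\rightarrow y))\rightarrow(x\wedge y\wedge(x\rightarrow y))=1$; (hN7) if $x\rightarrow y=1$, $y\rightarrow x=1$, $y\rightarrow z=1$ and $z\rightarrow y=1$ then $x\rightarrow z=1$ and $z\rightarrow x=1$; (hN8) if $x\rightarrow y=1$ and $y\rightarrow x=1$ then $(x\wedge z)\rightarrow(y\wedge z)=1$; (hN9) if $x\rightarrow y=1$ and $y\rightarrow x=1$ then $(x\vee z)\rightarrow(y\vee z)=1$; (hN10) if $x\rightarrow y=1$ and $y\rightarrow x=1$ then $(x\rightarrow z)\rightarrow(y\rightarrow z)=1$ and $(z\rightarrow x)\rightarrow(z\rightarrow y)=1$. -}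

module Defs where

open import Level using (Level)
open import Relation.Binary.PropositionalEquality using (_≡_)
open import Algebra.Core using (Op₁; Op₂)
open import Data.Product using (_×_)
open import Algebra.Lattice.Structures using (IsDistributiveLattice)

module _ {a : Level} (T : Set a)
         (_∧_ _∨_ _⇒_ : Op₂ T) (∼_ : Op₁ T) where

  _⇒N_ : Op₂ T
  x ⇒N y = x ⇒ (x ∧ y)

  record IsSemiNelson (one : T) : Set a where
    field
      SN1  : ∀ x y → x ∧ (x ∨ y) ≡ x
      SN2  : ∀ x y z → x ∧ (y ∨ z) ≡ (z ∧ x) ∨ (y ∧ x)
      SN3  : ∀ x → ∼ (∼ x) ≡ x
      SN4  : ∀ x y → ∼ (x ∧ y) ≡ (∼ x) ∨ (∼ y)
      SN5  : ∀ x y → x ∧ (∼ x) ≡ (x ∧ (∼ x)) ∧ (y ∨ (∼ y))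
      SN6  : ∀ x y → x ∧ (x ⇒N y) ≡ x ∧ ((∼ x) ∨ y)
      SN7  : ∀ x y z → x ⇒N (y ⇒N z) ≡ (x ∧ y) ⇒N z
      SN8  : ∀ x y z →
               (x ⇒N y) ⇒N ((y ⇒N x) ⇒N ((x ⇒ z) ⇒N (y ⇒ z))) ≡ one
      SN9  : ∀ x y z →
               (x ⇒N y) ⇒N ((y ⇒N x) ⇒N ((z ⇒ x) ⇒N (z ⇒ y))) ≡ one
      SN10 : ∀ x y → (∼ (x ⇒ y)) ⇒N (x ∧ (∼ y)) ≡ one
      SN11 : ∀ x y → (x ∧ (∼ y)) ⇒N (∼ (x ⇒ y)) ≡ one

  _≤_ : T → T → Set a
  x ≤ y = x ∧ y ≡ x

  record IsKleene (zero one : T) : Set a where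
    field
      isDistributiveLattice : IsDistributiveLattice _≡_ _∨_ _∧_
      zero-least  : ∀ x → zero ≤ x
      one-greatest : ∀ x → x ≤ one
      involutive  : ∀ x → ∼ (∼ x) ≡ x
      deMorgan    : ∀ x y → ∼ (x ∧ y) ≡ (∼ x) ∨ (∼ y)
      kleene      : ∀ x y → (x ∧ (∼ x)) ∧ (y ∨ (∼ y)) ≡ x ∧ (∼ x)

  record IsHemiNelson (zero one : T) : Set a where
    field
      isKleene : IsKleene zero one
      hN1  : ∀ x → x ⇒ x ≡ one
      hN2  : ∀ x y → (x ∧ (x ⇒ y)) ≤ (x ∧ ((∼ x) ∨ y))
      hN3  : ∀ x y → (∼ (x ⇒ y)) ⇒ (x ∧ (∼ y)) ≡ one
      hN4  : ∀ x y → (x ∧ (∼ y)) ⇒ (∼ (x ⇒ y)) ≡ one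
      hN5  : ∀ x y → ((x ∧ y) ∧ (x ⇒ y)) ⇒ (x ∧ (x ⇒ y)) ≡ one
      hN6  : ∀ x y → (x ∧ (x ⇒ y)) ⇒ ((x ∧ y) ∧ (x ⇒ y)) ≡ one
      hN7  : ∀ x y z → x ⇒ y ≡ one → y ⇒ x ≡ one → y ⇒ z ≡ one → z ⇒ y ≡ one →
               (x ⇒ z ≡ one) × (z ⇒ x ≡ one)
      hN8  : ∀ x y z → x ⇒ y ≡ one → y ⇒ x ≡ one → (x ∧ z) ⇒ (y ∧ z) ≡ one
      hN9  : ∀ x y z → x ⇒ y ≡ one → y ⇒ x ≡ one → (x ∨ z) ⇒ (y ∨ z) ≡ one
      hN10 : ∀ x y z → x ⇒ y ≡ one → y ⇒ x ≡ one →
               ((x ⇒ z) ⇒ (y ⇒ z) ≡ one) × ((z ⇒ x) ⇒ (z ⇒ y) ≡ one)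

{-# OPTIONS --safe #-}
-- SN1–SN4 are Sholander's axioms for distributive lattices plus De Morgan's laws, so the
-- relation x ∧ y = x is a lattice order and ∧, ∨, ∼ form a De Morgan lattice, Kleene by SN5.
-- The implication is read off through x ⊑ y := x ≤ ∼ x ∨ y: by SN6 and SN7, x ⇒N y = 1 iff
-- x ⊑ y, and SN8 and SN9 with premises equal to 1 say that x ≃ y (x ⊑ y and y ⊑ x) is a
-- congruence for ⇒ and forces x ⇒ y = 1.  In a Kleene lattice x ⊑ y and ∼ y ⊑ ∼ x give
-- x ≤ y; with SN7 and SN10 this yields x ≤ y ⇒N x and then the modus ponens
-- x ∧ (x ⇒ y) ⊑ y, so that x ⇒ y = 1 implies x ⊑ y.  Each hemi-Nelson axiom is then a
-- statement about ≃.
module Submission where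

open import Defs using (IsSemiNelson; IsHemiNelson; IsKleene)
open import Level using (Level)
open import Algebra.Core using (Op₁; Op₂)
open import Algebra.Lattice.Structures using (IsDistributiveLattice)
open import Data.Product using (_×_; _,_; proj₁; proj₂)
open import Relation.Binary.Core using (Rel)
open import Relation.Binary.Bundles using (Poset)
open import Relation.Binary.Structures using (IsPartialOrder)
open import Relation.Binary.PropositionalEquality
open import Function.Base using (_∘_)
import Relation.Binary.Lattice as Ord
import Relation.Binary.Lattice.Properties.Lattice as LatticeProperties
import Relation.Binary.Lattice.Properties.DistributiveLattice as DistributiveLatticeProperties
import Relation.Binary.Lattice.Properties.MeetSemilattice as MeetSemilatticeProperties
import Relation.Binary.Lattice.Properties.JoinSemilattice as JoinSemilatticeProperties
import Relation.Binary.Reasoning.PartialOrder as PartialOrderReasoning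

module DeMorganLattice {a} {T : Set a} (meet join : Op₂ T) (neg : Op₁ T) where

  infix  8 ∼_
  infixr 7 _∧_
  infixr 6 _∨_
  infix  4 _≤_ _⊑_ _≃_

  _∧_ _∨_ : Op₂ T
  _∧_ = meet
  _∨_ = join

  ∼_ : Op₁ T
  ∼_ = neg

  _≤_ : Rel T a
  x ≤ y = x ∧ y ≡ x

  _⊑_ : Rel T a
  x ⊑ y = x ≤ ∼ x ∨ y

  _≃_ : Rel T a
  x ≃ y = x ⊑ y × y ⊑ x

  module Sholander
    (∧-absorbs-∨ : ∀ x y → x ∧ (x ∨ y) ≡ x)
    (sholander-distrib : ∀ x y z → x ∧ (y ∨ z) ≡ z ∧ x ∨ y ∧ x)
    (∼-involutive : ∀ x → ∼ ∼ x ≡ x)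
    (∼-deMorgan : ∀ x y → ∼ (x ∧ y) ≡ ∼ x ∨ ∼ y)
    where

    private
      variable
        x y z : T

    ∧-idem : ∀ x → x ∧ x ≡ x
    ∧-idem x = begin
      x ∧ x                      ≡⟨ cong (x ∧_) x∧x∨x∧x≡x ⟨
      x ∧ (x ∧ x ∨ x ∧ x)        ≡⟨ sholander-distrib x (x ∧ x) (x ∧ x) ⟩
      (x ∧ x) ∧ x ∨ (x ∧ x) ∧ x  ≡⟨ cong₂ _∨_ [x∧x]∧x≡x∧x [x∧x]∧x≡x∧x ⟩
      x ∧ x ∨ x ∧ x              ≡⟨ x∧x∨x∧x≡x ⟩
      x                          ∎
      where
      open ≡-Reasoning
      x∧x∨x∧x≡x : x ∧ x ∨ x ∧ x ≡ x
      x∧x∨x∧x≡x = trans (sym (sholander-distrib x x x)) (∧-absorbs-∨ x x)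
      [x∧x]∧x≡x∧x : (x ∧ x) ∧ x ≡ x ∧ x
      [x∧x]∧x≡x∧x = trans (cong ((x ∧ x) ∧_) (sym x∧x∨x∧x≡x)) (∧-absorbs-∨ (x ∧ x) (x ∧ x))

    ∨-idem : ∀ x → x ∨ x ≡ x
    ∨-idem x = begin
      x ∨ x          ≡⟨ cong₂ _∨_ (∧-idem x) (∧-idem x) ⟨
      x ∧ x ∨ x ∧ x  ≡⟨ sholander-distrib x x x ⟨
      x ∧ (x ∨ x)    ≡⟨ ∧-absorbs-∨ x x ⟩
      x              ∎
      where open ≡-Reasoning

    ∧-comm : ∀ x y → x ∧ y ≡ y ∧ x
    ∧-comm x y = begin
      x ∧ y            ≡⟨ cong (x ∧_) (∨-idem y) ⟨
      x ∧ (y ∨ y)      ≡⟨ sholander-distrib x y y ⟩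
      y ∧ x ∨ y ∧ x    ≡⟨ ∨-idem (y ∧ x) ⟩
      y ∧ x            ∎
      where open ≡-Reasoning

    ∨-via-∧ : ∀ x y → x ∨ y ≡ ∼ (∼ x ∧ ∼ y)
    ∨-via-∧ x y = sym (trans (∼-deMorgan (∼ x) (∼ y)) (cong₂ _∨_ (∼-involutive x) (∼-involutive y)))

    ∼-deMorgan-∨ : ∀ x y → ∼ (x ∨ y) ≡ ∼ x ∧ ∼ y
    ∼-deMorgan-∨ x y = trans (cong ∼_ (∨-via-∧ x y)) (∼-involutive (∼ x ∧ ∼ y))

    ∼[∼x∨y]≡x∧∼y : ∀ x y → ∼ (∼ x ∨ y) ≡ x ∧ ∼ y
    ∼[∼x∨y]≡x∧∼y x y = trans (∼-deMorgan-∨ (∼ x) y) (cong (_∧ ∼ y) (∼-involutive x))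

    ∨-comm : ∀ x y → x ∨ y ≡ y ∨ x
    ∨-comm x y = begin
      x ∨ y            ≡⟨ ∨-via-∧ x y ⟩
      ∼ (∼ x ∧ ∼ y)    ≡⟨ cong ∼_ (∧-comm (∼ x) (∼ y)) ⟩
      ∼ (∼ y ∧ ∼ x)    ≡⟨ ∨-via-∧ y x ⟨
      y ∨ x            ∎
      where open ≡-Reasoning

    x∧y∨y≡y : ∀ x y → x ∧ y ∨ y ≡ y
    x∧y∨y≡y x y = begin
      x ∧ y ∨ y      ≡⟨ cong (x ∧ y ∨_) (∧-idem y) ⟨
      x ∧ y ∨ y ∧ y  ≡⟨ sholander-distrib y y x ⟨
      y ∧ (y ∨ x)    ≡⟨ ∧-absorbs-∨ y x ⟩
      y              ∎
      where open ≡-Reasoning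

    x≤y⇒x∨y≡y : x ≤ y → x ∨ y ≡ y
    x≤y⇒x∨y≡y {x} {y} x≤y = trans (cong (_∨ y) (sym x≤y)) (x∧y∨y≡y x y)

    x∨y≡y⇒x≤y : x ∨ y ≡ y → x ≤ y
    x∨y≡y⇒x≤y {x} {y} x∨y≡y = trans (cong (x ∧_) (sym x∨y≡y)) (∧-absorbs-∨ x y)

    ≤-refl : x ≤ x
    ≤-refl {x} = ∧-idem x

    ≤-reflexive : x ≡ y → x ≤ y
    ≤-reflexive refl = ≤-refl

    ≤-antisym : x ≤ y → y ≤ x → x ≡ y
    ≤-antisym {x} {y} x≤y y≤x = trans (sym x≤y) (trans (∧-comm x y) y≤x)

    ≤-trans : x ≤ y → y ≤ z → x ≤ z
    ≤-trans {x} {y} {z} x≤y y≤z = begin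
      x ∧ z          ≡⟨ cong (x ∧_) (x≤y⇒x∨y≡y y≤z) ⟨
      x ∧ (y ∨ z)    ≡⟨ sholander-distrib x y z ⟩
      z ∧ x ∨ y ∧ x  ≡⟨ cong (z ∧ x ∨_) (trans (∧-comm y x) x≤y) ⟩
      z ∧ x ∨ x      ≡⟨ x∧y∨y≡y z x ⟩
      x              ∎
      where open ≡-Reasoning

    x∧y≤y : ∀ x y → x ∧ y ≤ y
    x∧y≤y x y = x∨y≡y⇒x≤y (x∧y∨y≡y x y)

    x∧y≤x : ∀ x y → x ∧ y ≤ x
    x∧y≤x x y = subst (_≤ x) (∧-comm y x) (x∧y≤y y x)

    x≤x∨y : ∀ x y → x ≤ x ∨ y
    x≤x∨y = ∧-absorbs-∨

    y≤x∨y : ∀ x y → y ≤ x ∨ y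
    y≤x∨y x y = subst (y ≤_) (∨-comm y x) (x≤x∨y y x)

    ∧-greatest : z ≤ x → z ≤ y → z ≤ x ∧ y
    ∧-greatest {z} {x} {y} z≤x z≤y = x∨y≡y⇒x≤y (begin
      z ∨ x ∧ y          ≡⟨ ∨-comm z (x ∧ y) ⟩
      x ∧ y ∨ z          ≡⟨ cong₂ _∨_ (∧-comm y x) z≤x ⟨
      y ∧ x ∨ z ∧ x      ≡⟨ sholander-distrib x z y ⟨
      x ∧ (z ∨ y)        ≡⟨ cong (x ∧_) (x≤y⇒x∨y≡y z≤y) ⟩
      x ∧ y              ∎)
      where open ≡-Reasoning

    ∨-least : x ≤ z → y ≤ z → x ∨ y ≤ z
    ∨-least {x} {z} {y} x≤z y≤z = begin
      (x ∨ y) ∧ z        ≡⟨ ∧-comm (x ∨ y) z ⟩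
      z ∧ (x ∨ y)        ≡⟨ sholander-distrib z x y ⟩
      y ∧ z ∨ x ∧ z      ≡⟨ cong₂ _∨_ y≤z x≤z ⟩
      y ∨ x              ≡⟨ ∨-comm y x ⟩
      x ∨ y              ∎
      where open ≡-Reasoning

    ∼-antitone : x ≤ y → ∼ y ≤ ∼ x
    ∼-antitone {x} {y} x≤y =
      x∨y≡y⇒x≤y (trans (∨-comm (∼ y) (∼ x)) (trans (sym (∼-deMorgan x y)) (cong ∼_ x≤y)))

    ≤-isPartialOrder : IsPartialOrder _≡_ _≤_
    ≤-isPartialOrder = record
      { isPreorder = record
        { isEquivalence = isEquivalence
        ; reflexive     = ≤-reflexive
        ; trans         = ≤-trans
        }
      ; antisym = ≤-antisym
      }

    ≤-poset : Poset a a a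
    ≤-poset = record { isPartialOrder = ≤-isPartialOrder }

    ≤-distributiveLattice : Ord.DistributiveLattice a a a
    ≤-distributiveLattice = record
      { isDistributiveLattice = record
        { isLattice = record
          { isPartialOrder = ≤-isPartialOrder
          ; supremum       = λ x y → x≤x∨y x y , y≤x∨y x y , λ _ → ∨-least
          ; infimum        = λ x y → x∧y≤x x y , x∧y≤y x y , λ _ → ∧-greatest
          }
        ; ∧-distribˡ-∨ = λ x y z →
            trans (sholander-distrib x y z)
                  (trans (∨-comm (z ∧ x) (y ∧ x)) (cong₂ _∨_ (∧-comm y x) (∧-comm z x)))
        }
      }

    open Ord.DistributiveLattice ≤-distributiveLattice using (lattice; meetSemilattice; joinSemilattice)

    isDistributiveLattice : IsDistributiveLattice _≡_ _∨_ _∧_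
    isDistributiveLattice = record
      { isLattice   = LatticeProperties.isAlgLattice lattice
      ; ∨-distrib-∧ = DistributiveLatticeProperties.∨-distrib-∧ ≤-distributiveLattice
      ; ∧-distrib-∨ = DistributiveLatticeProperties.∧-distrib-∨ ≤-distributiveLattice
      }

    open IsDistributiveLattice isDistributiveLattice public
      using (∧-assoc; ∧-distribˡ-∨; ∧-distribʳ-∨; ∨-distribˡ-∧; ∨-distribʳ-∧)
    open MeetSemilatticeProperties meetSemilattice public using (∧-monotonic)
    open JoinSemilatticeProperties joinSemilattice public using (∨-monotonic)
    open PartialOrderReasoning ≤-poset

    ⊑-refl : x ⊑ x
    ⊑-refl {x} = y≤x∨y (∼ x) x

    ≤⇒⊑ : x ≤ y → x ⊑ y
    ≤⇒⊑ {x} {y} x≤y = ≤-trans x≤y (y≤x∨y (∼ x) y)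

    ≤-⊑-trans : x ≤ y → y ⊑ z → x ⊑ z
    ≤-⊑-trans x≤y y⊑z = ≤-trans x≤y (≤-trans y⊑z (∨-monotonic (∼-antitone x≤y) ≤-refl))

    ⊑-≤-trans : x ⊑ y → y ≤ z → x ⊑ z
    ⊑-≤-trans x⊑y y≤z = ≤-trans x⊑y (∨-monotonic ≤-refl y≤z)

    ⊑⇒∧∼≤∼ : x ⊑ y → x ∧ ∼ y ≤ ∼ x
    ⊑⇒∧∼≤∼ {x} {y} x⊑y = subst (_≤ ∼ x) (∼[∼x∨y]≡x∧∼y x y) (∼-antitone x⊑y)

    ⊑-trans : x ⊑ y → y ⊑ z → x ⊑ z
    ⊑-trans {x} {y} {z} x⊑y y⊑z = begin
      x                          ≡⟨ x⊑y ⟨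
      x ∧ (∼ x ∨ y)              ≡⟨ ∧-distribˡ-∨ x (∼ x) y ⟩
      x ∧ ∼ x ∨ x ∧ y            ≤⟨ ∨-monotonic (x∧y≤y x (∼ x)) (∧-monotonic ≤-refl y⊑z) ⟩
      ∼ x ∨ x ∧ (∼ y ∨ z)        ≡⟨ cong (∼ x ∨_) (∧-distribˡ-∨ x (∼ y) z) ⟩
      ∼ x ∨ (x ∧ ∼ y ∨ x ∧ z)    ≤⟨ ∨-monotonic ≤-refl (∨-monotonic (⊑⇒∧∼≤∼ x⊑y) (x∧y≤y x z)) ⟩
      ∼ x ∨ (∼ x ∨ z)            ≤⟨ ∨-least (x≤x∨y (∼ x) z) ≤-refl ⟩
      ∼ x ∨ z                    ∎

    ∧-greatest-⊑ : x ⊑ y → x ⊑ z → x ⊑ y ∧ z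
    ∧-greatest-⊑ {x} {y} {z} x⊑y x⊑z = begin
      x                          ≤⟨ ∧-greatest x⊑y x⊑z ⟩
      (∼ x ∨ y) ∧ (∼ x ∨ z)      ≡⟨ ∨-distribˡ-∧ (∼ x) y z ⟨
      ∼ x ∨ y ∧ z                ∎

    x∧[∼x∨y]⊑y : ∀ x y → x ∧ (∼ x ∨ y) ⊑ y
    x∧[∼x∨y]⊑y x y = begin
      x ∧ (∼ x ∨ y)                    ≡⟨ ∧-distribˡ-∨ x (∼ x) y ⟩
      x ∧ ∼ x ∨ x ∧ y                  ≤⟨ ∨-monotonic (x∧y≤y x (∼ x)) (x∧y≤y x y) ⟩
      ∼ x ∨ y                          ≤⟨ ∨-monotonic (x≤x∨y (∼ x) (∼ (∼ x ∨ y))) ≤-refl ⟩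
      (∼ x ∨ ∼ (∼ x ∨ y)) ∨ y          ≡⟨ cong (_∨ y) (∼-deMorgan x (∼ x ∨ y)) ⟨
      ∼ (x ∧ (∼ x ∨ y)) ∨ y            ∎

    ∧-monoˡ-⊑ : x ⊑ y → x ∧ z ⊑ y ∧ z
    ∧-monoˡ-⊑ {x} {y} {z} x⊑y = begin
      x ∧ z                  ≤⟨ ∧-monotonic x⊑y ≤-refl ⟩
      (∼ x ∨ y) ∧ z          ≡⟨ ∧-distribʳ-∨ z (∼ x) y ⟩
      ∼ x ∧ z ∨ y ∧ z        ≤⟨ ∨-monotonic (≤-trans (x∧y≤x (∼ x) z) (x≤x∨y (∼ x) (∼ z))) ≤-refl ⟩
      (∼ x ∨ ∼ z) ∨ y ∧ z    ≡⟨ cong (_∨ y ∧ z) (∼-deMorgan x z) ⟨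
      ∼ (x ∧ z) ∨ y ∧ z      ∎

    ≃-sym : x ≃ y → y ≃ x
    ≃-sym (x⊑y , y⊑x) = y⊑x , x⊑y

    ≃-trans : x ≃ y → y ≃ z → x ≃ z
    ≃-trans (x⊑y , y⊑x) (y⊑z , z⊑y) = ⊑-trans x⊑y y⊑z , ⊑-trans z⊑y y⊑x

    ∧-congʳ-≃ : x ≃ y → x ∧ z ≃ y ∧ z
    ∧-congʳ-≃ (x⊑y , y⊑x) = ∧-monoˡ-⊑ x⊑y , ∧-monoˡ-⊑ y⊑x

    module Kleene (kleene : ∀ x y → x ∧ ∼ x ≤ y ∨ ∼ y) where

      ⊑∧∼⊑∼⇒≤ : x ⊑ y → ∼ y ⊑ ∼ x → x ≤ y
      ⊑∧∼⊑∼⇒≤ {x} {y} x⊑y ∼y⊑∼x = begin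
        x                      ≡⟨ x⊑y ⟨
        x ∧ (∼ x ∨ y)          ≡⟨ ∧-distribˡ-∨ x (∼ x) y ⟩
        x ∧ ∼ x ∨ x ∧ y        ≤⟨ ∨-monotonic x∧∼x≤y (x∧y≤y x y) ⟩
        y ∨ y                  ≡⟨ ∨-idem y ⟩
        y                      ∎
        where
        ∼y∧x≤y : ∼ y ∧ x ≤ y
        ∼y∧x≤y = subst₂ (λ s t → ∼ y ∧ s ≤ t) (∼-involutive x) (∼-involutive y) (⊑⇒∧∼≤∼ ∼y⊑∼x)
        x∧∼x≤y : x ∧ ∼ x ≤ y
        x∧∼x≤y = begin
          x ∧ ∼ x              ≤⟨ ∧-greatest (kleene x y) (≤-trans (x∧y≤x x (∼ x)) (y≤x∨y y x)) ⟩
          (y ∨ ∼ y) ∧ (y ∨ x)  ≡⟨ ∨-distribˡ-∧ y (∼ y) x ⟨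
          y ∨ ∼ y ∧ x          ≤⟨ ∨-least ≤-refl ∼y∧x≤y ⟩
          y                    ∎

      ∨-monoˡ-⊑ : x ⊑ y → x ∨ z ⊑ y ∨ z
      ∨-monoˡ-⊑ {x} {y} {z} x⊑y =
        ∨-least x≤∼[x∨z]∨[y∨z] (≤-trans (y≤x∨y y z) (y≤x∨y (∼ (x ∨ z)) (y ∨ z)))
        where
        x∧∼x≤∼[x∨z]∨z : x ∧ ∼ x ≤ ∼ (x ∨ z) ∨ z
        x∧∼x≤∼[x∨z]∨z = begin
          x ∧ ∼ x                ≤⟨ ∧-greatest (≤-trans (x∧y≤y x (∼ x)) (x≤x∨y (∼ x) z))
                                               (≤-trans (kleene x z) (≤-reflexive (∨-comm z (∼ z)))) ⟩
          (∼ x ∨ z) ∧ (∼ z ∨ z)  ≡⟨ ∨-distribʳ-∧ z (∼ x) (∼ z) ⟨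
          ∼ x ∧ ∼ z ∨ z          ≡⟨ cong (_∨ z) (∼-deMorgan-∨ x z) ⟨
          ∼ (x ∨ z) ∨ z          ∎
        x≤∼[x∨z]∨[y∨z] : x ≤ ∼ (x ∨ z) ∨ (y ∨ z)
        x≤∼[x∨z]∨[y∨z] = begin
          x                      ≡⟨ x⊑y ⟨
          x ∧ (∼ x ∨ y)          ≡⟨ ∧-distribˡ-∨ x (∼ x) y ⟩
          x ∧ ∼ x ∨ x ∧ y        ≤⟨ ∨-monotonic x∧∼x≤∼[x∨z]∨z (x∧y≤y x y) ⟩
          (∼ (x ∨ z) ∨ z) ∨ y    ≤⟨ ∨-least (∨-monotonic ≤-refl (y≤x∨y y z))
                                            (≤-trans (x≤x∨y y z) (y≤x∨y (∼ (x ∨ z)) (y ∨ z))) ⟩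
          ∼ (x ∨ z) ∨ (y ∨ z)    ∎

      ∨-congʳ-≃ : x ≃ y → x ∨ z ≃ y ∨ z
      ∨-congʳ-≃ (x⊑y , y⊑x) = ∨-monoˡ-⊑ x⊑y , ∨-monoˡ-⊑ y⊑x

module SemiNelson {a} {T : Set a} (meet join imp : Op₂ T) (neg : Op₁ T) (one : T)
  (isSemiNelson : IsSemiNelson T meet join imp neg one) where

  open IsSemiNelson isSemiNelson
  open DeMorganLattice meet join neg
  open Sholander SN1 SN2 SN3 SN4 public
  open ≡-Reasoning

  kleene : ∀ x y → x ∧ ∼ x ≤ y ∨ ∼ y
  kleene x y = sym (SN5 x y)

  open Kleene kleene public

  infixr 5 _⇒_ _⇒N_

  _⇒_ : Op₂ T
  _⇒_ = imp

  _⇒N_ : Op₂ T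
  x ⇒N y = x ⇒ (x ∧ y)

  private
    variable
      x y z : T

  ⇒N-idem : x ⇒N (x ⇒N y) ≡ x ⇒N y
  ⇒N-idem {x} {y} = trans (SN7 x x y) (cong (_⇒N y) (∧-idem x))

  ⊑⇒≤⇒N : x ⊑ y → x ≤ x ⇒N y
  ⊑⇒≤⇒N {x} {y} x⊑y = trans (SN6 x y) x⊑y

  x≤x⇒x : x ≤ x ⇒ x
  x≤x⇒x {x} = subst (λ t → x ≤ x ⇒ t) (∧-idem x) (⊑⇒≤⇒N ⊑-refl)

  [x⇒x]⇒N[x⇒x]≡one : (x ⇒ x) ⇒N (x ⇒ x) ≡ one
  [x⇒x]⇒N[x⇒x]≡one {x} = begin
    u ⇒N u                              ≡⟨ ⇒N-idem ⟨
    u ⇒N (u ⇒N u)                       ≡⟨ cong (u ⇒N_) ⇒N-idem ⟨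
    u ⇒N (u ⇒N (u ⇒N u))                ≡⟨ cong (λ t → t ⇒N (t ⇒N (u ⇒N u))) x⇒Nx≡u ⟨
    (x ⇒N x) ⇒N ((x ⇒N x) ⇒N (u ⇒N u))  ≡⟨ SN8 x x x ⟩
    one                                 ∎
    where
    u : T
    u = x ⇒ x
    x⇒Nx≡u : x ⇒N x ≡ u
    x⇒Nx≡u = cong (x ⇒_) (∧-idem x)

  x⇒x≤one : x ⇒ x ≤ one
  x⇒x≤one {x} = subst (x ⇒ x ≤_) [x⇒x]⇒N[x⇒x]≡one (⊑⇒≤⇒N ⊑-refl)

  x≤one : x ≤ one
  x≤one = ≤-trans x≤x⇒x x⇒x≤one

  ∼one≤x : ∼ one ≤ x
  ∼one≤x {x} = subst (∼ one ≤_) (SN3 x) (∼-antitone x≤one)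

  one∧x≡x : one ∧ x ≡ x
  one∧x≡x {x} = trans (∧-comm one x) x≤one

  one⇒N : one ⇒N x ≡ x
  one⇒N {x} = begin
    one ⇒N x            ≡⟨ one∧x≡x ⟨
    one ∧ (one ⇒N x)    ≡⟨ SN6 one x ⟩
    one ∧ (∼ one ∨ x)   ≡⟨ one∧x≡x ⟩
    ∼ one ∨ x           ≡⟨ x≤y⇒x∨y≡y ∼one≤x ⟩
    x                   ∎

  one⇒ : one ⇒ x ≡ x
  one⇒ {x} = trans (cong (one ⇒_) (sym one∧x≡x)) one⇒N

  ⇒-refl : x ⇒ x ≡ one
  ⇒-refl {x} = begin
    u
      ≡⟨ x⇒None≡u ⟨
    x ⇒N one
      ≡⟨ cong (x ⇒N_) [x⇒x]⇒N[x⇒x]≡one ⟨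
    x ⇒N (u ⇒N u)
      ≡⟨ cong (λ t → x ⇒N (u ⇒N t)) x⇒Nu≡u ⟨
    x ⇒N (u ⇒N (x ⇒N u))
      ≡⟨ cong₂ (λ s t → s ⇒N (t ⇒N (x ⇒N u))) one⇒N x⇒None≡u ⟨
    (one ⇒N x) ⇒N ((x ⇒N one) ⇒N (x ⇒N u))
      ≡⟨ cong (λ t → (one ⇒N x) ⇒N ((x ⇒N one) ⇒N (t ⇒N u))) one⇒ ⟨
    (one ⇒N x) ⇒N ((x ⇒N one) ⇒N ((one ⇒ x) ⇒N u))
      ≡⟨ SN8 one x x ⟩
    one ∎
    where
    u : T
    u = x ⇒ x
    x⇒None≡u : x ⇒N one ≡ u
    x⇒None≡u = cong (x ⇒_) x≤one
    x⇒Nu≡u : x ⇒N u ≡ u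
    x⇒Nu≡u = cong (x ⇒_) x≤x⇒x

  ⇒N≡one⇒⊑ : x ⇒N y ≡ one → x ⊑ y
  ⇒N≡one⇒⊑ {x} {y} x⇒Ny≡one = begin
    x ∧ (∼ x ∨ y)   ≡⟨ SN6 x y ⟨
    x ∧ (x ⇒N y)    ≡⟨ cong (x ∧_) x⇒Ny≡one ⟩
    x ∧ one         ≡⟨ x≤one ⟩
    x               ∎

  ⊑⇒⇒N≡one : x ⊑ y → x ⇒N y ≡ one
  ⊑⇒⇒N≡one {x} {y} x⊑y = begin
    x ⇒N y              ≡⟨ ⇒N-idem ⟨
    x ⇒ (x ∧ (x ⇒N y))  ≡⟨ cong (x ⇒_) (⊑⇒≤⇒N x⊑y) ⟩
    x ⇒ x               ≡⟨ ⇒-refl ⟩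
    one                 ∎

  ⇒N-mp : x ≡ one → x ⇒N y ≡ one → y ≡ one
  ⇒N-mp refl one⇒Ny≡one = trans (sym one⇒N) one⇒Ny≡one

  ⇒N-mp₂ : x ≡ one → y ≡ one → x ⇒N (y ⇒N z) ≡ one → z ≡ one
  ⇒N-mp₂ x≡one y≡one = ⇒N-mp y≡one ∘ ⇒N-mp x≡one

  ≃⇒⇒≡one : x ≃ y → x ⇒ y ≡ one
  ≃⇒⇒≡one {x} {y} (x⊑y , y⊑x) = ⇒N-mp (⊑⇒⇒N≡one x⊑y) [x⇒Ny]⇒N[x⇒y]≡one
    where
    [x⇒Ny]⇒N[x⇒y]≡one : (x ⇒N y) ⇒N (x ⇒ y) ≡ one
    [x⇒Ny]⇒N[x⇒y]≡one =
      ⇒N-mp₂ (⊑⇒⇒N≡one (≤⇒⊑ (x∧y≤y x y))) (⊑⇒⇒N≡one (∧-greatest-⊑ y⊑x ⊑-refl)) (SN9 (x ∧ y) y x)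

  ⇒-congʳ-≃ : x ≃ y → x ⇒ z ≃ y ⇒ z
  ⇒-congʳ-≃ {x} {y} {z} (x⊑y , y⊑x) =
    ⇒N≡one⇒⊑ (⇒N-mp₂ (⊑⇒⇒N≡one x⊑y) (⊑⇒⇒N≡one y⊑x) (SN8 x y z)) ,
    ⇒N≡one⇒⊑ (⇒N-mp₂ (⊑⇒⇒N≡one y⊑x) (⊑⇒⇒N≡one x⊑y) (SN8 y x z))

  ⇒-congˡ-≃ : x ≃ y → z ⇒ x ≃ z ⇒ y
  ⇒-congˡ-≃ {x} {y} {z} (x⊑y , y⊑x) =
    ⇒N≡one⇒⊑ (⇒N-mp₂ (⊑⇒⇒N≡one x⊑y) (⊑⇒⇒N≡one y⊑x) (SN9 x y z)) ,
    ⇒N≡one⇒⊑ (⇒N-mp₂ (⊑⇒⇒N≡one y⊑x) (⊑⇒⇒N≡one x⊑y) (SN9 y x z))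

  ∼⇒≃∧∼ : ∼ (x ⇒ y) ≃ x ∧ ∼ y
  ∼⇒≃∧∼ {x} {y} = ⇒N≡one⇒⊑ (SN10 x y) , ⇒N≡one⇒⊑ (SN11 x y)

  x≤y⇒Nx : ∀ x y → x ≤ y ⇒N x
  x≤y⇒Nx x y = ⊑∧∼⊑∼⇒≤ x⊑y⇒Nx ∼[y⇒Nx]⊑∼x
    where
    x⊑y⇒Nx : x ⊑ y ⇒N x
    x⊑y⇒Nx = ⇒N≡one⇒⊑ (trans (SN7 x y x) (⊑⇒⇒N≡one (≤⇒⊑ (x∧y≤x x y))))
    ∼[y⇒Nx]⊑∼x : ∼ (y ⇒N x) ⊑ ∼ x
    ∼[y⇒Nx]⊑∼x =
      ⊑-trans (proj₁ ∼⇒≃∧∼) (subst (λ t → y ∧ t ⊑ ∼ x) (sym (SN4 y x)) (x∧[∼x∨y]⊑y y (∼ x)))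

  x∧[x⇒y]⊑y : ∀ x y → x ∧ (x ⇒ y) ⊑ y
  x∧[x⇒y]⊑y x y = ⊑-trans x∧[x⇒y]⊑x∧[x⇒Ny] (subst (_⊑ y) (sym (SN6 x y)) (x∧[∼x∨y]⊑y x y))
    where
    y∧[x∧y]≡y∧x : y ∧ (x ∧ y) ≡ y ∧ x
    y∧[x∧y]≡y∧x =
      trans (cong (y ∧_) (∧-comm x y)) (trans (sym (∧-assoc y y x)) (cong (_∧ x) (∧-idem y)))

    [y⇒Nx]∧[x⇒y]⊑x⇒Ny : (y ⇒N x) ∧ (x ⇒ y) ⊑ x ⇒N y
    [y⇒Nx]∧[x⇒y]⊑x⇒Ny = ⇒N≡one⇒⊑ (begin
      ((y ⇒N x) ∧ (x ⇒ y)) ⇒N (x ⇒N y)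
        ≡⟨ SN7 (y ⇒N x) (x ⇒ y) (x ⇒N y) ⟨
      (y ⇒N x) ⇒N ((x ⇒ y) ⇒N (x ⇒N y))
        ≡⟨ cong (λ t → (y ⇒ t) ⇒N ((x ⇒ y) ⇒N (x ⇒N y))) y∧[x∧y]≡y∧x ⟨
      (y ⇒N (x ∧ y)) ⇒N ((x ⇒ y) ⇒N (x ⇒N y))
        ≡⟨ cong ((y ⇒N (x ∧ y)) ⇒N_) one⇒N ⟨
      (y ⇒N (x ∧ y)) ⇒N (one ⇒N ((x ⇒ y) ⇒N (x ⇒N y)))
        ≡⟨ cong (λ t → (y ⇒N (x ∧ y)) ⇒N (t ⇒N ((x ⇒ y) ⇒N (x ⇒N y))))
                (⊑⇒⇒N≡one (≤⇒⊑ (x∧y≤y x y))) ⟨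
      (y ⇒N (x ∧ y)) ⇒N (((x ∧ y) ⇒N y) ⇒N ((x ⇒ y) ⇒N (x ⇒N y)))
        ≡⟨ SN9 y (x ∧ y) x ⟩
      one ∎)

    x∧[x⇒y]⊑x∧[x⇒Ny] : x ∧ (x ⇒ y) ⊑ x ∧ (x ⇒N y)
    x∧[x⇒y]⊑x∧[x⇒Ny] = ∧-greatest-⊑ (≤⇒⊑ (x∧y≤x x (x ⇒ y)))
      (≤-⊑-trans (∧-monotonic (x≤y⇒Nx x y) ≤-refl) [y⇒Nx]∧[x⇒y]⊑x⇒Ny)

  ⇒≡one⇒⊑ : x ⇒ y ≡ one → x ⊑ y
  ⇒≡one⇒⊑ {x} {y} x⇒y≡one = subst (_⊑ y) (trans (cong (x ∧_) x⇒y≡one) x≤one) (x∧[x⇒y]⊑y x y)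

  ⇒≡one⇒≃ : x ⇒ y ≡ one → y ⇒ x ≡ one → x ≃ y
  ⇒≡one⇒≃ x⇒y≡one y⇒x≡one = ⇒≡one⇒⊑ x⇒y≡one , ⇒≡one⇒⊑ y⇒x≡one

  x∧[x⇒y]≤x∧[∼x∨y] : ∀ x y → x ∧ (x ⇒ y) ≤ x ∧ (∼ x ∨ y)
  x∧[x⇒y]≤x∧[∼x∨y] x y =
    ∧-greatest (x∧y≤x x (x ⇒ y)) (⊑∧∼⊑∼⇒≤ x∧[x⇒y]⊑∼x∨y ∼[∼x∨y]⊑∼[x∧[x⇒y]])
    where
    x∧[x⇒y]⊑∼x∨y : x ∧ (x ⇒ y) ⊑ ∼ x ∨ y
    x∧[x⇒y]⊑∼x∨y = ⊑-≤-trans (x∧[x⇒y]⊑y x y) (y≤x∨y (∼ x) y)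
    ∼[∼x∨y]⊑∼[x∧[x⇒y]] : ∼ (∼ x ∨ y) ⊑ ∼ (x ∧ (x ⇒ y))
    ∼[∼x∨y]⊑∼[x∧[x⇒y]] = subst (_⊑ ∼ (x ∧ (x ⇒ y))) (sym (∼[∼x∨y]≡x∧∼y x y))
      (⊑-≤-trans (proj₂ ∼⇒≃∧∼) (∼-antitone (x∧y≤y x (x ⇒ y))))

  [x∧y]∧[x⇒y]≃x∧[x⇒y] : (x ∧ y) ∧ (x ⇒ y) ≃ x ∧ (x ⇒ y)
  [x∧y]∧[x⇒y]≃x∧[x⇒y] {x} {y} =
    ≤⇒⊑ (∧-monotonic (x∧y≤x x y) ≤-refl) ,
    subst (x ∧ (x ⇒ y) ⊑_) y∧[x∧[x⇒y]]≡[x∧y]∧[x⇒y] (∧-greatest-⊑ (x∧[x⇒y]⊑y x y) ⊑-refl)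
    where
    y∧[x∧[x⇒y]]≡[x∧y]∧[x⇒y] : y ∧ (x ∧ (x ⇒ y)) ≡ (x ∧ y) ∧ (x ⇒ y)
    y∧[x∧[x⇒y]]≡[x∧y]∧[x⇒y] = trans (sym (∧-assoc y x (x ⇒ y))) (cong (_∧ (x ⇒ y)) (∧-comm y x))

  isKleene : IsKleene T meet join imp neg (∼ one) one
  isKleene = record
    { isDistributiveLattice = isDistributiveLattice
    ; zero-least            = λ _ → ∼one≤x
    ; one-greatest          = λ _ → x≤one
    ; involutive            = SN3
    ; deMorgan              = SN4
    ; kleene                = kleene
    }

proposition41 : ∀ {a : Level} (T : Set a) (_∧_ _∨_ _⇒_ : Op₂ T) (∼_ : Op₁ T) (one : T) →
    IsSemiNelson T _∧_ _∨_ _⇒_ ∼_ one →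
    IsHemiNelson T _∧_ _∨_ _⇒_ ∼_ (∼ one) one
proposition41 T meet join imp neg one isSemiNelson = record
  { isKleene = isKleene
  ; hN1      = λ _ → ⇒-refl
  ; hN2      = x∧[x⇒y]≤x∧[∼x∨y]
  ; hN3      = λ _ _ → ≃⇒⇒≡one ∼⇒≃∧∼
  ; hN4      = λ _ _ → ≃⇒⇒≡one (≃-sym ∼⇒≃∧∼)
  ; hN5      = λ _ _ → ≃⇒⇒≡one [x∧y]∧[x⇒y]≃x∧[x⇒y]
  ; hN6      = λ _ _ → ≃⇒⇒≡one (≃-sym [x∧y]∧[x⇒y]≃x∧[x⇒y])
  ; hN7      = λ _ _ _ x⇒y y⇒x y⇒z z⇒y →
      let x≃z = ≃-trans (⇒≡one⇒≃ x⇒y y⇒x) (⇒≡one⇒≃ y⇒z z⇒y)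
      in  ≃⇒⇒≡one x≃z , ≃⇒⇒≡one (≃-sym x≃z)
  ; hN8      = λ _ _ _ x⇒y y⇒x → ≃⇒⇒≡one (∧-congʳ-≃ (⇒≡one⇒≃ x⇒y y⇒x))
  ; hN9      = λ _ _ _ x⇒y y⇒x → ≃⇒⇒≡one (∨-congʳ-≃ (⇒≡one⇒≃ x⇒y y⇒x))
  ; hN10     = λ _ _ _ x⇒y y⇒x →
      ≃⇒⇒≡one (⇒-congʳ-≃ (⇒≡one⇒≃ x⇒y y⇒x)) , ≃⇒⇒≡one (⇒-congˡ-≃ (⇒≡one⇒≃ x⇒y y⇒x))
  }
  where open SemiNelson meet join imp neg one isSemiNelson
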